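{- In $\mathcal{U}^n$, for any $k\ge2$ and any pairwise distinct $i_1,\ldots,i_k\in\{1,\ldots,n\}$, $$(1+u_{i_1i_2})(1+u_{i_2i_3})\cdots(1+u_{i_ki_1})=(1+v_{i_1i_2i_3})(1+v_{i_1i_3i_4})\cdots(1+v_{i_1i_{k-1}i_k})$$ (the right side being $1$ when $k=2$); moreover, for distinct $i,j,k$, $v_{ijk}=v_{jki}=-v_{ikj}$ and $v_{ijk}^2=0$.
   Context: $\mathcal{U}^n$ is the commutative algebra (over $\mathbb{C}$) generated by elements $u_{ij}$ for $i\ne j$ in $\{1,\ldots,n\}$, with $u_{ij}=-u_{ji}$, subject to the relations $u_{ij}^2=0$ and $u_{ij}u_{jk}+u_{jk}u_{ki}+u_{ki}u_{ij}=0$ for distinct $i,j,k$. Set $v_{ijk}=u_{ij}+u_{jk}+u_{ki}$ for distinct $i,j,k$. -}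

module Defs where

open import Level using (_⊔_)
open import Data.Nat using (ℕ; zero; suc)
open import Data.Fin using (Fin; zero; suc; inject₁; fromℕ)
open import Data.Product using (_×_)
open import Relation.Binary.PropositionalEquality using (_≡_; _≢_)
open import Algebra.Bundles using (CommutativeRing)

Distinct3 : ∀ {n} → Fin n → Fin n → Fin n → Set
Distinct3 i j k = (i ≢ j) × (j ≢ k) × (i ≢ k)

module _ {c ℓ} (R : CommutativeRing c ℓ) where
  open CommutativeRing R hiding (zero)

  -- A family of elements u i j (i ≠ j) of the commutative ring R satisfying
  -- the defining relations of 𝒰ⁿ.  (The diagonal values u i i are irrelevant.)
  record URel (n : ℕ) : Set (c ⊔ ℓ) where
    field
      u       : Fin n → Fin n → Carrier
      u-anti  : ∀ i j → i ≢ j → u i j ≈ - u j i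
      u-sq    : ∀ i j → i ≢ j → u i j * u i j ≈ 0#
      u-three : ∀ i j k → Distinct3 i j k →
                u i j * u j k + u j k * u k i + u k i * u i j ≈ 0#

  ∏ : ∀ {m} → (Fin m → Carrier) → Carrier
  ∏ {zero}  f = 1#
  ∏ {suc m} f = f zero * ∏ (λ a → f (suc a))

  module _ {n : ℕ} (U : URel n) where
    open URel U

    v : Fin n → Fin n → Fin n → Carrier
    v i j k = u i j + u j k + u k i

    -- For a sequence i₁,…,i_k with k = m + 2 (here i : Fin (2+m) → Fin n, 0-indexed):
    -- (1+u_{i₁i₂})(1+u_{i₂i₃})⋯(1+u_{i_{k-1}i_k}) (1+u_{i_k i₁})
    cycleLHS : ∀ m → (Fin (suc (suc m)) → Fin n) → Carrier
    cycleLHS m i =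
      ∏ (λ (a : Fin (suc m)) → 1# + u (i (inject₁ a)) (i (suc a)))
        * (1# + u (i (fromℕ (suc m))) (i zero))

    fanRHS : ∀ m → (Fin (suc (suc m)) → Fin n) → Carrier
    fanRHS m i =
      ∏ (λ (a : Fin m) → 1# + v (i zero) (i (suc (inject₁ a))) (i (suc (suc a))))

-- Write w = u_{zx} = -u_{xz}.  Expanding (1+v_{xyz})(1-w) gives
-- (1+u_{xy})(1+u_{yz}) minus w² and minus the cubic relation
-- u_{xy}u_{yz}+u_{yz}u_{zx}+u_{zx}u_{xy}, both of which vanish; hence
-- (1+u_{xy})(1+u_{yz}) = (1+v_{xyz})(1+u_{xz}).  Contracting the first two factors
-- of the cycle in this way with x = i₁ again and again turns it into the fan
-- product times (1+u_{i₁i_k})(1+u_{i_ki₁}) = 1 - u_{i₁i_k}² = 1.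
module Submission where

open import Defs
open import Level using (Level)
open import Data.Nat using (ℕ; zero; suc)
open import Data.Fin using (Fin; zero; suc; inject₁; fromℕ)
open import Data.Fin.Properties using (suc-injective; 0≢1+n; <⇒≢; ≤̄⇒inject₁<; ≤-refl)
open import Data.Product using (_×_; _,_)
open import Data.Maybe using (nothing)
open import Relation.Binary.PropositionalEquality using (_≡_; _≢_; ≢-sym)
open import Function.Definitions using (Injective)
open import Algebra.Bundles using (CommutativeRing)
open import Tactic.RingSolver using (solve-∀)
open import Tactic.RingSolver.Core.AlmostCommutativeRing using (AlmostCommutativeRing; fromCommutativeRing)
import Relation.Binary.Reasoning.Setoid as SetoidReasoning

module RingIdentities {c ℓ} (R : CommutativeRing c ℓ) where
  acRing : AlmostCommutativeRing c ℓ
  acRing = fromCommutativeRing R (λ _ → nothing)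
  open AlmostCommutativeRing acRing

  -- Without a zero test the solver can neither cancel x - x nor simplify
  -- 1# * 1#, so these identities avoid subtraction and keep the unit as a
  -- variable o.
  [o+x]*[o+y]-expand : ∀ o x y → (o + x) * (o + y) + x * x ≈ o * o + (o + x) * (x + y)
  [o+x]*[o+y]-expand = solve-∀ acRing

  [o+x]*[o+y]-contract : ∀ o x y z w →
    (o + (x + y + z)) * (o + w) + z * z + (x * y + y * z + z * x)
      ≈ (o + x) * (o + y) + (o + (x + y + z)) * (z + w)
  [o+x]*[o+y]-contract = solve-∀ acRing

  [x+y+z]²-expand : ∀ x y z → (x + y + z) * (x + y + z)
                  ≈ x * x + y * y + z * z + (x * y + y * z + z * x) + (x * y + y * z + z * x)
  [x+y+z]²-expand = solve-∀ acRing

  x+y+z≈y+z+x : ∀ x y z → x + y + z ≈ y + z + x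
  x+y+z≈y+z+x = solve-∀ acRing

  -x+-y+-z≈-[z+y+x] : ∀ x y z → - x + - y + - z ≈ - (z + y + x)
  -x+-y+-z≈-[z+y+x] = solve-∀ acRing

module NilpotentIdentities {c ℓ} (R : CommutativeRing c ℓ) where
  open CommutativeRing R
  open RingIdentities R using ([o+x]*[o+y]-expand; [o+x]*[o+y]-contract; [x+y+z]²-expand)
  open SetoidReasoning setoid

  private
    +-cancel-zeros : ∀ {x y z} → y ≈ 0# → z ≈ 0# → x + y + z ≈ x
    +-cancel-zeros {x} {y} {z} y≈0 z≈0 = begin
      x + y + z   ≈⟨ +-cong (+-congˡ y≈0) z≈0 ⟩
      x + 0# + 0# ≈⟨ trans (+-identityʳ _) (+-identityʳ _) ⟩
      x           ∎

    *-annihilateʳ : ∀ {x y} → y ≈ 0# → x * y ≈ 0#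
    *-annihilateʳ {x} y≈0 = trans (*-congˡ y≈0) (zeroʳ x)

  [1+x]*[1+y]≈1 : ∀ x y → x * x ≈ 0# → x + y ≈ 0# → (1# + x) * (1# + y) ≈ 1#
  [1+x]*[1+y]≈1 x y x²≈0 x+y≈0 = begin
    (1# + x) * (1# + y)                   ≈⟨ sym (+-identityʳ _) ⟩
    (1# + x) * (1# + y) + 0#              ≈⟨ +-congˡ (sym x²≈0) ⟩
    (1# + x) * (1# + y) + x * x           ≈⟨ [o+x]*[o+y]-expand 1# x y ⟩
    1# * 1# + (1# + x) * (x + y)          ≈⟨ +-cong (*-identityˡ 1#) (*-annihilateʳ x+y≈0) ⟩
    1# + 0#                               ≈⟨ +-identityʳ 1# ⟩
    1#                                    ∎

  [1+x]*[1+y]≈[1+x+y+z]*[1+w] : ∀ x y z w → z * z ≈ 0# → x * y + y * z + z * x ≈ 0# → z + w ≈ 0# →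
                         (1# + x) * (1# + y) ≈ (1# + (x + y + z)) * (1# + w)
  [1+x]*[1+y]≈[1+x+y+z]*[1+w] x y z w z²≈0 cubic≈0 z+w≈0 = begin
    (1# + x) * (1# + y)
      ≈⟨ sym (+-identityʳ _) ⟩
    (1# + x) * (1# + y) + 0#
      ≈⟨ +-congˡ (sym (*-annihilateʳ z+w≈0)) ⟩
    (1# + x) * (1# + y) + (1# + (x + y + z)) * (z + w)
      ≈⟨ sym ([o+x]*[o+y]-contract 1# x y z w) ⟩
    (1# + (x + y + z)) * (1# + w) + z * z + (x * y + y * z + z * x)
      ≈⟨ +-cancel-zeros z²≈0 cubic≈0 ⟩
    (1# + (x + y + z)) * (1# + w)
      ∎

  [x+y+z]²≈0 : ∀ x y z → x * x ≈ 0# → y * y ≈ 0# → z * z ≈ 0# →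
               x * y + y * z + z * x ≈ 0# → (x + y + z) * (x + y + z) ≈ 0#
  [x+y+z]²≈0 x y z x²≈0 y²≈0 z²≈0 cubic≈0 = begin
    (x + y + z) * (x + y + z)                           ≈⟨ [x+y+z]²-expand x y z ⟩
    x * x + y * y + z * z + cubic + cubic                ≈⟨ +-cancel-zeros cubic≈0 cubic≈0 ⟩
    x * x + y * y + z * z                                ≈⟨ +-cancel-zeros y²≈0 z²≈0 ⟩
    x * x                                                ≈⟨ x²≈0 ⟩
    0#                                                   ∎
    where
    cubic = x * y + y * z + z * x

module URelProperties {c ℓ} (R : CommutativeRing c ℓ) {n : ℕ} (U : URel R n) where
  open CommutativeRing R hiding (zero)
  open URel U
  open RingIdentities R using (x+y+z≈y+z+x; -x+-y+-z≈-[z+y+x])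
  open NilpotentIdentities R
  open SetoidReasoning setoid

  vᵁ : Fin n → Fin n → Fin n → Carrier
  vᵁ = v R U

  u-cancel : ∀ i j → i ≢ j → u i j + u j i ≈ 0#
  u-cancel i j i≢j = trans (+-congʳ (u-anti i j i≢j)) (-‿inverseˡ (u j i))

  1+u-inverse : ∀ i j → i ≢ j → (1# + u i j) * (1# + u j i) ≈ 1#
  1+u-inverse i j i≢j = [1+x]*[1+y]≈1 (u i j) (u j i) (u-sq i j i≢j) (u-cancel i j i≢j)

  1+u-contract : ∀ x y z → Distinct3 x y z →
                 (1# + u x y) * (1# + u y z) ≈ (1# + vᵁ x y z) * (1# + u x z)
  1+u-contract x y z xyz@(_ , _ , x≢z) =
    [1+x]*[1+y]≈[1+x+y+z]*[1+w] (u x y) (u y z) (u z x) (u x z)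
      (u-sq z x (≢-sym x≢z)) (u-three x y z xyz) (u-cancel z x (≢-sym x≢z))

  v-rotate : ∀ i j k → vᵁ i j k ≈ vᵁ j k i
  v-rotate i j k = x+y+z≈y+z+x (u i j) (u j k) (u k i)

  v-swap : ∀ i j k → Distinct3 i j k → vᵁ i j k ≈ - vᵁ i k j
  v-swap i j k (i≢j , j≢k , i≢k) = begin
    u i j + u j k + u k i          ≈⟨ +-cong (+-cong (u-anti i j i≢j) (u-anti j k j≢k))
                                              (u-anti k i (≢-sym i≢k)) ⟩
    - u j i + - u k j + - u i k    ≈⟨ -x+-y+-z≈-[z+y+x] (u j i) (u k j) (u i k) ⟩
    - (u i k + u k j + u j i)      ∎

  v-square : ∀ i j k → Distinct3 i j k → vᵁ i j k * vᵁ i j k ≈ 0#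
  v-square i j k (i≢j , j≢k , i≢k) =
    [x+y+z]²≈0 (u i j) (u j k) (u k i) (u-sq i j i≢j) (u-sq j k j≢k) (u-sq k i (≢-sym i≢k))
               (u-three i j k (i≢j , j≢k , i≢k))

  pathProduct : ∀ m → (Fin (suc m) → Fin n) → Carrier
  pathProduct m j = ∏ R (λ a → 1# + u (j (inject₁ a)) (j (suc a)))

  fanProduct : ∀ m → Fin n → (Fin (suc m) → Fin n) → Carrier
  fanProduct m x j = ∏ R (λ (a : Fin m) → 1# + vᵁ x (j (inject₁ a)) (j (suc a)))

  loop≈fan : ∀ m x (j : Fin (suc m) → Fin n) → (∀ a → x ≢ j a) →
             (∀ (a : Fin m) → j (inject₁ a) ≢ j (suc a)) →
             (1# + u x (j zero)) * (pathProduct m j * (1# + u (j (fromℕ m)) x))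
               ≈ fanProduct m x j
  loop≈fan zero x j x∉j _ = begin
    (1# + u x (j zero)) * (1# * (1# + u (j zero) x)) ≈⟨ *-congˡ (*-identityˡ _) ⟩
    (1# + u x (j zero)) * (1# + u (j zero) x)        ≈⟨ 1+u-inverse x (j zero) (x∉j zero) ⟩
    1#                                               ∎
  loop≈fan (suc m) x j x∉j j-steps = begin
    A * ((B * P) * C)  ≈⟨ *-congˡ (*-assoc B P C) ⟩
    A * (B * (P * C))  ≈⟨ sym (*-assoc A B (P * C)) ⟩
    (A * B) * (P * C)  ≈⟨ *-congʳ (1+u-contract x (j zero) (j (suc zero))
                                     (x∉j zero , j-steps zero , x∉j (suc zero))) ⟩
    (V * D) * (P * C)  ≈⟨ *-assoc V D (P * C) ⟩
    V * (D * (P * C))  ≈⟨ *-congˡ (loop≈fan m x (λ a → j (suc a)) (λ a → x∉j (suc a))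
                                                (λ a → j-steps (suc a))) ⟩
    V * fanProduct m x (λ a → j (suc a)) ∎
    where
    A = 1# + u x (j zero)
    B = 1# + u (j zero) (j (suc zero))
    P = pathProduct m (λ a → j (suc a))
    C = 1# + u (j (suc (fromℕ m))) x
    V = 1# + vᵁ x (j zero) (j (suc zero))
    D = 1# + u x (j (suc zero))

  cycle≈fan : ∀ m (i : Fin (suc (suc m)) → Fin n) → Injective _≡_ _≡_ i →
              cycleLHS R U m i ≈ fanRHS R U m i
  cycle≈fan m i i-inj =
    trans (*-assoc _ _ _) (loop≈fan m (i zero) (λ a → i (suc a)) i₀∉tail tail-steps)
    where
    i₀∉tail : ∀ a → i zero ≢ i (suc a)
    i₀∉tail a eq = 0≢1+n (i-inj eq)
    tail-steps : ∀ (a : Fin m) → i (suc (inject₁ a)) ≢ i (suc (suc a))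
    tail-steps a eq = <⇒≢ (≤̄⇒inject₁< ≤-refl) (suc-injective (i-inj eq))

proposition42 : ∀ {c ℓ : Level} (R : CommutativeRing c ℓ) (n : ℕ) (U : URel R n) →
    (∀ (m : ℕ) (i : Fin (suc (suc m)) → Fin n) → Injective _≡_ _≡_ i →
      CommutativeRing._≈_ R (cycleLHS R U m i) (fanRHS R U m i))
    × (∀ (i j k : Fin n) → Distinct3 i j k →
      CommutativeRing._≈_ R (v R U i j k) (v R U j k i)
      × CommutativeRing._≈_ R (v R U i j k) (CommutativeRing.-_ R (v R U i k j))
      × CommutativeRing._≈_ R (CommutativeRing._*_ R (v R U i j k) (v R U i j k)) (CommutativeRing.0# R))
proposition42 R n U =
    cycle≈fan
  , λ i j k ijk-distinct → v-rotate i j k , v-swap i j k ijk-distinct , v-square i j k ijk-distinct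
  where open URelProperties R U
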